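{- The category $\mathrm{LO}^{\mathrm{mon}}$ admits modality elimination: for every modal $\mathcal L^{\Diamond}_{\le}$-formula $\theta(\bar x)$, the formula $\Diamond\theta(\bar x)$ is equivalent in $\mathrm{LO}^{\mathrm{mon}}$ (at every world under every valuation) to a modality-free $\mathcal L_{\le}$-formula. More precisely, if the tuple $\bar x$ of free variables is nonempty, then $\Diamond\theta(\bar x)$ is equivalent to the disjunction, over all ordered partitions $Q$ of $\bar x$ such that $Q(\bar x)\wedge\theta(\bar x)$ is satisfied at some world under some valuation, of the finite disjunction of all ordered partitions $P$ of $\bar x$ with $P\preccurlyeq Q$. If $\theta$ has no free variables, then $\Diamond\theta$ is equivalent to one of: false, true, or the sentence "the order is empty".
   Context: A linear order is a set with a total order $\le$; linear orders may be empty. $\mathcal L_{\le}=\{\le\}$ and $\mathcal L^{\Diamond}_{\le}$ is its extension by modal operators $\Diamond,\Box$. $\mathrm{LO}^{\mathrm{mon}}$ is the category whose objects are linear orders and whose morphisms are monotone maps ($x\le y\Rightarrow f(x)\le f(y)$). Modal satisfaction: $U\models\Diamond\varphi[\nu]$ iff there is a morphism $f:U\to V$ with $V\models\varphi[f\circ\nu]$; $\Box$ dually (for all morphisms). An ordered partition of variables $x_0,\dots,x_{n-1}$ is a partition of $\{0,\dots,n-1\}$ into blocks with a linear order of the blocks $B_0<\dots<B_{r-1}$, identified with the formula $P(\bar x)$ saying $x_i=x_j$ for $i,j$ in a common block and $x_i<x_j$ for $i\in B_m$, $j\in B_{m'}$, $m<m'$. For ordered partitions $P,Q$, $P\preccurlyeq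 Q$ means $Q$ is obtained from $P$ by merging (possibly no) adjacent blocks. -}

module Defs where

open import Level using (Level; Lift; lift; _⊔_) renaming (zero to lzero; suc to lsuc)
open import Data.Nat using (ℕ; zero; suc)
open import Data.Fin using (Fin; _<_; _≤_)
open import Data.Vec.Functional using (_∷_)
open import Data.Product using (Σ; Σ-syntax; ∃; ∃-syntax; _×_; _,_)
open import Data.Sum using (_⊎_)
open import Data.Unit.Polymorphic using (⊤)
open import Data.Empty.Polymorphic using (⊥)
open import Relation.Binary.PropositionalEquality using (_≡_; _≢_)
open import Relation.Binary.Structures using (IsTotalOrder)
open import Function using (_∘_)

record LinOrd : Set₁ where
  field
    Carrier      : Set
    _≤ₒ_         : Carrier → Carrier → Set
    isTotalOrder : IsTotalOrder _≡_ _≤ₒ_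

  _<ₒ_ : Carrier → Carrier → Set
  x <ₒ y = (x ≤ₒ y) × (x ≢ y)

open LinOrd public

record Mono (U V : LinOrd) : Set where
  field
    fun  : Carrier U → Carrier V
    mono : ∀ {x y} → _≤ₒ_ U x y → _≤ₒ_ V (fun x) (fun y)

open Mono public

data Formula : ℕ → Set where
  _≤'_ : ∀ {n} → Fin n → Fin n → Formula n
  _≐_  : ∀ {n} → Fin n → Fin n → Formula n
  ⊤' ⊥' : ∀ {n} → Formula n
  ¬'_  : ∀ {n} → Formula n → Formula n
  _∧'_ _∨'_ _⇒'_ : ∀ {n} → Formula n → Formula n → Formula n
  ∀' ∃' : ∀ {n} → Formula (suc n) → Formula n
  ◇ □  : ∀ {n} → Formula n → Formula n

data ModalFree : ∀ {n} → Formula n → Set where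
  mf≤ : ∀ {n} (i j : Fin n) → ModalFree (i ≤' j)
  mf≐ : ∀ {n} (i j : Fin n) → ModalFree (i ≐ j)
  mf⊤ : ∀ {n} → ModalFree (⊤' {n})
  mf⊥ : ∀ {n} → ModalFree (⊥' {n})
  mf¬ : ∀ {n} {φ : Formula n} → ModalFree φ → ModalFree (¬' φ)
  mf∧ : ∀ {n} {φ ψ : Formula n} → ModalFree φ → ModalFree ψ → ModalFree (φ ∧' ψ)
  mf∨ : ∀ {n} {φ ψ : Formula n} → ModalFree φ → ModalFree ψ → ModalFree (φ ∨' ψ)
  mf⇒ : ∀ {n} {φ ψ : Formula n} → ModalFree φ → ModalFree ψ → ModalFree (φ ⇒' ψ)
  mf∀ : ∀ {n} {φ : Formula (suc n)} → ModalFree φ → ModalFree (∀' φ)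
  mf∃ : ∀ {n} {φ : Formula (suc n)} → ModalFree φ → ModalFree (∃' φ)

Sat : ∀ {n} (U : LinOrd) → Formula n → (Fin n → Carrier U) → Set₁
Sat U (i ≤' j) ν = Lift (lsuc lzero) (_≤ₒ_ U (ν i) (ν j))
Sat U (i ≐ j)  ν = Lift (lsuc lzero) (ν i ≡ ν j)
Sat U ⊤' ν = ⊤
Sat U ⊥' ν = ⊥
Sat U (¬' φ) ν = Sat U φ ν → ⊥ {lzero}
Sat U (φ ∧' ψ) ν = Sat U φ ν × Sat U ψ ν
Sat U (φ ∨' ψ) ν = Sat U φ ν ⊎ Sat U ψ ν
Sat U (φ ⇒' ψ) ν = Sat U φ ν → Sat U ψ ν
Sat U (∀' φ) ν = (a : Carrier U) → Sat U φ (a ∷ ν)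
Sat U (∃' φ) ν = Σ[ a ∈ Carrier U ] Sat U φ (a ∷ ν)
Sat U (◇ φ) ν = Σ[ V ∈ LinOrd ] Σ[ f ∈ Mono U V ] Sat V φ (fun f ∘ ν)
Sat U (□ φ) ν = (V : LinOrd) (f : Mono U V) → Sat V φ (fun f ∘ ν)

infix 3 _⇔₁_
_⇔₁_ : Set₁ → Set₁ → Set₁
A ⇔₁ B = (A → B) × (B → A)

-- Ordered partitions of the variables x_0..x_{n-1}:
-- blocks B_0 < ... < B_{r-1} given by a surjective block-index map.

record OPart (n : ℕ) : Set where
  field
    r    : ℕ
    blk  : Fin n → Fin r
    surj : ∀ (k : Fin r) → ∃[ i ] blk i ≡ k

open OPart public

HoldsP : ∀ {n} (U : LinOrd) → OPart n → (Fin n → Carrier U) → Set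
HoldsP {n} U P ν = ∀ (i j : Fin n) → (blk P i ≡ blk P j → ν i ≡ ν j)
                                   × (blk P i < blk P j → _<ₒ_ U (ν i) (ν j))

-- P ≼ Q : Q is obtained from P by merging (possibly no) adjacent blocks,
-- i.e. Q's block map factors through P's by a monotone map on block indices.
_≼_ : ∀ {n} → OPart n → OPart n → Set
P ≼ Q = Σ[ g ∈ (Fin (r P) → Fin (r Q)) ]
          (∀ {k l} → k ≤ l → g k ≤ g l) × (∀ i → blk Q i ≡ g (blk P i))

DiamondNF : ∀ {n} (θ : Formula n) (U : LinOrd) → (Fin n → Carrier U) → Set₁
DiamondNF {n} θ U ν =
  Σ[ Q ∈ OPart n ] (Σ[ V ∈ LinOrd ] Σ[ μ ∈ (Fin n → Carrier V) ]
                       (Lift (lsuc lzero) (HoldsP V Q μ) × Sat V θ μ))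
                 × (Σ[ P ∈ OPart n ] Lift (lsuc lzero) (P ≼ Q × HoldsP U P ν))

IsEmptyOrder : LinOrd → Set₁
IsEmptyOrder U = Carrier U → ⊥ {lsuc lzero}

{-# OPTIONS --safe #-}

-- If every order relation among the values ν i also holds among the μ i, the assignment
-- ν i ↦ μ i extends to a monotone map h (send u to the μ-value of the greatest ν i ≤ u, or to
-- the least μ-value if there is none; this is where x̄ ≠ ∅ is needed), and a witness f of ◇θ
-- at μ gives the witness f ∘ h at ν. So whether ◇θ holds depends only on the ordered partition
-- realised by x̄: it holds iff that partition refines one realised together with θ somewhere.
-- With excluded middle every property of this kind is defined by a decision tree over the
-- atoms xᵢ ≤ xⱼ. Without variables, ◇θ holds at U iff θ holds in some V receiving a monotone
-- map from U: always if θ holds in a nonempty order (constant maps), and exactly for empty U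
-- if θ holds only in the empty order.
module Submission where

open import Defs
open import Level using () renaming (suc to lsuc; zero to lzero)
open import Axiom.ExcludedMiddle using (ExcludedMiddle)
open import Data.Nat using (ℕ; zero; suc)
open import Data.Fin using (Fin)
open import Data.Product using (Σ-syntax; _×_)
open import Data.Sum using (_⊎_)
open import Data.Unit.Polymorphic using (⊤)
open import Data.Empty.Polymorphic using (⊥)

open import Level using (lift; lower)
open import Data.Bool using (Bool; true; false)
open import Data.Empty using (⊥-elim)
open import Data.Fin using (zero; suc; _≤_; _<_; punchIn; punchOut)
open import Data.Fin.Properties
  using (≤-reflexive; ≤-antisym; ≤-isTotalOrder; <-cmp; _≟_;
         punchInᵢ≢i; punchIn-mono-≤; punchIn-cancel-≤; punchIn-punchOut)
open import Data.List using (List; []; _∷_; map; allFin; cartesianProduct)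
open import Data.List.Properties using (∷-injectiveˡ; ∷-injectiveʳ)
open import Data.List.Membership.Propositional using (_∈_)
open import Data.List.Membership.Propositional.Properties using (∈-allFin; ∈-cartesianProduct⁺)
open import Data.List.Relation.Unary.Any using (here; there)
open import Data.Nat using (z≤n; s≤s; s≤s⁻¹)
open import Data.Nat.Properties using (<⇒≤; <⇒≱)
open import Data.Product using (_,_; proj₁; proj₂; uncurry)
open import Data.Sum using (inj₁; inj₂)
open import Data.Unit.Polymorphic using (tt)
open import Data.Vec.Functional.Properties using (∷-cong)
open import Function using (_∘_; id)
open import Function.Bundles using (_⇔_; mk⇔; module Equivalence)
open import Function.Construct.Composition using (_⇔-∘_)
open import Function.Construct.Symmetry using (⇔-sym)
open import Function.Related.TypeIsomorphisms using (¬-cong-⇔)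
open import Relation.Binary.Core using (Rel)
open import Relation.Binary.Definitions using (Decidable; tri<; tri≈; tri>)
open import Relation.Binary.PropositionalEquality
  using (_≡_; _≢_; refl; sym; trans; cong; subst; subst₂; _≗_)
open import Relation.Binary.Structures using (IsTotalOrder)
open import Relation.Nullary using (¬_; Dec; yes; no; does; contradiction)
open import Relation.Nullary.Decidable using (map′)

open Equivalence using (to; from)

module LO (U : LinOrd) = IsTotalOrder (isTotalOrder U)

≥⇔≰ : ∀ {a ℓ} {A : Set a} {_⊑_ : Rel A ℓ} → IsTotalOrder _≡_ _⊑_ →
      ∀ {x y} → x ≢ y → (y ⊑ x) ⇔ (¬ x ⊑ y)
≥⇔≰ {_⊑_ = _⊑_} tot {x} {y} x≢y = mk⇔ (λ y⊑x x⊑y → x≢y (antisym x⊑y y⊑x)) ≰⇒≥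
  where
  open IsTotalOrder tot
  ≰⇒≥ : ¬ x ⊑ y → y ⊑ x
  ≰⇒≥ x⋢y with total x y
  ... | inj₁ x⊑y = contradiction x⊑y x⋢y
  ... | inj₂ y⊑x = y⊑x

punchIn≤⇔< : ∀ {n} (p : Fin (suc n)) (x : Fin n) → punchIn p x ≤ p ⇔ x < p
punchIn≤⇔< zero    x           = mk⇔ (λ ()) (λ ())
punchIn≤⇔< (suc p) zero    = mk⇔ (λ _ → s≤s z≤n) (λ _ → z≤n)
punchIn≤⇔< (suc p) (suc x) = mk⇔ (s≤s ∘ to IH ∘ s≤s⁻¹) (s≤s ∘ from IH ∘ s≤s⁻¹)
  where IH = punchIn≤⇔< p x

map-≡-∈ : ∀ {a b} {A : Set a} {B : Set b} {f g : A → B} {x} (xs : List A) →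
          map f xs ≡ map g xs → x ∈ xs → f x ≡ g x
map-≡-∈ (y ∷ ys) eq (here refl) = ∷-injectiveˡ eq
map-≡-∈ (y ∷ ys) eq (there x∈) = map-≡-∈ ys (∷-injectiveʳ eq) x∈

does-≡⇒ : ∀ {a b} {A : Set a} {B : Set b} (a? : Dec A) (b? : Dec B) →
          does a? ≡ does b? → A → B
does-≡⇒ _       (yes b) _  _ = b
does-≡⇒ (yes a) (no _)  () _
does-≡⇒ (no ¬a) (no _)  _  a = contradiction a ¬a

Sat-cong : ∀ {n} (U : LinOrd) (φ : Formula n) {ν ν' : Fin n → Carrier U} →
           ν ≗ ν' → Sat U φ ν → Sat U φ ν'
Sat-cong U (i ≤' j) e (lift i≤j) = lift (subst₂ (_≤ₒ_ U) (e i) (e j) i≤j)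
Sat-cong U (i ≐ j)  e (lift i≡j) = lift (trans (sym (e i)) (trans i≡j (e j)))
Sat-cong U ⊤'       e s = s
Sat-cong U ⊥'       e s = s
Sat-cong U (¬' φ)   e s = s ∘ Sat-cong U φ (sym ∘ e)
Sat-cong U (φ ∧' ψ) e (s , t) = Sat-cong U φ e s , Sat-cong U ψ e t
Sat-cong U (φ ∨' ψ) e (inj₁ s) = inj₁ (Sat-cong U φ e s)
Sat-cong U (φ ∨' ψ) e (inj₂ t) = inj₂ (Sat-cong U ψ e t)
Sat-cong U (φ ⇒' ψ) e s = Sat-cong U ψ e ∘ s ∘ Sat-cong U φ (sym ∘ e)
Sat-cong U (∀' φ)   e s = λ a → Sat-cong U φ (∷-cong refl e) (s a)
Sat-cong U (∃' φ)   e (a , s) = a , Sat-cong U φ (∷-cong refl e) s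
Sat-cong U (◇ φ)    e (V , f , s) = V , f , Sat-cong V φ (cong (fun f) ∘ e) s
Sat-cong U (□ φ)    e s = λ V f → Sat-cong V φ (cong (fun f) ∘ e) (s V f)

idₘ : ∀ {U} → Mono U U
idₘ = record { fun = id ; mono = id }

_∘ₘ_ : ∀ {U V W} → Mono V W → Mono U V → Mono U W
g ∘ₘ f = record { fun = fun g ∘ fun f ; mono = mono g ∘ mono f }

constₘ : ∀ {U V} → Carrier V → Mono U V
constₘ {V = V} v = record { fun = λ _ → v ; mono = λ _ → LO.refl V }

emptyₘ : ∀ {U V} → IsEmptyOrder U → Mono U V
emptyₘ empty = record { fun  = λ u → ⊥-elim (lower (empty u))
                       ; mono = λ {u} _ → ⊥-elim (lower (empty u)) }

MonoOn : ∀ {n} (U V : LinOrd) → (Fin n → Carrier U) → (Fin n → Carrier V) → Set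
MonoOn U V ν μ = ∀ i j → _≤ₒ_ U (ν i) (ν j) → _≤ₒ_ V (μ i) (μ j)

GreatestBelow : ∀ {n} (U : LinOrd) → (Fin n → Carrier U) → Carrier U → Set
GreatestBelow {n} U ν u =
  (∀ i → ¬ _≤ₒ_ U (ν i) u)
  ⊎ Σ[ c ∈ Fin n ] _≤ₒ_ U (ν c) u × (∀ i → _≤ₒ_ U (ν i) u → _≤ₒ_ U (ν i) (ν c))

greatestBelow : (U : LinOrd) → Decidable (_≤ₒ_ U) →
                ∀ {n} (ν : Fin n → Carrier U) u → GreatestBelow U ν u
greatestBelow U _≤?_ {zero}  ν u = inj₁ λ ()
greatestBelow U _≤?_ {suc n} ν u with ν zero ≤? u | greatestBelow U _≤?_ (ν ∘ suc) u
... | no 0⋠u | inj₁ none = inj₁ λ { zero → 0⋠u ; (suc i) → none i }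
... | no 0⋠u | inj₂ (c , c≤u , max) =
  inj₂ (suc c , c≤u , λ { zero 0≤u → contradiction 0≤u 0⋠u ; (suc i) → max i })
... | yes 0≤u | inj₁ none =
  inj₂ (zero , 0≤u , λ { zero _ → LO.refl U ; (suc i) i≤u → contradiction i≤u (none i) })
... | yes 0≤u | inj₂ (c , c≤u , max) with LO.total U (ν zero) (ν (suc c))
...   | inj₁ 0≤c = inj₂ (suc c , c≤u , λ { zero _ → 0≤c ; (suc i) → max i })
...   | inj₂ c≤0 =
  inj₂ (zero , 0≤u , λ { zero _ → LO.refl U ; (suc i) i≤u → LO.trans U (max i i≤u) c≤0 })

least : (U : LinOrd) → ∀ {n} (ν : Fin (suc n) → Carrier U) →
        Σ[ c ∈ Fin (suc n) ] (∀ i → _≤ₒ_ U (ν c) (ν i))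
least U {zero}  ν = zero , λ { zero → LO.refl U }
least U {suc n} ν with least U (ν ∘ suc)
... | c , min with LO.total U (ν zero) (ν (suc c))
...   | inj₁ 0≤c = zero , λ { zero → LO.refl U ; (suc i) → LO.trans U 0≤c (min i) }
...   | inj₂ c≤0 = suc c , λ { zero → c≤0 ; (suc i) → min i }

monotone-extension : ∀ {m} {U V : LinOrd} → Decidable (_≤ₒ_ U) →
                     (ν : Fin (suc m) → Carrier U) (μ : Fin (suc m) → Carrier V) →
                     MonoOn U V ν μ → Σ[ h ∈ Mono U V ] (fun h ∘ ν ≗ μ)
monotone-extension {U = U} {V} _≤?_ ν μ pres = h , λ k → value-at k (below (ν k))
  where
  below : ∀ u → GreatestBelow U ν u
  below = greatestBelow U _≤?_ ν

  value : ∀ {u} → GreatestBelow U ν u → Carrier V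
  value (inj₁ _)       = μ (proj₁ (least V μ))
  value (inj₂ (c , _)) = μ c

  value-mono : ∀ {u u'} → _≤ₒ_ U u u' → (g : GreatestBelow U ν u) (g' : GreatestBelow U ν u') →
               _≤ₒ_ V (value g) (value g')
  value-mono u≤u' (inj₁ _)             (inj₁ _)               = LO.refl V
  value-mono u≤u' (inj₁ _)             (inj₂ (c' , _))        = proj₂ (least V μ) c'
  value-mono u≤u' (inj₂ (c , c≤u , _)) (inj₁ none')           =
    contradiction (LO.trans U c≤u u≤u') (none' c)
  value-mono u≤u' (inj₂ (c , c≤u , _)) (inj₂ (c' , _ , max')) =
    pres c c' (max' c (LO.trans U c≤u u≤u'))

  value-at : ∀ k (g : GreatestBelow U ν (ν k)) → value g ≡ μ k
  value-at k (inj₁ none)           = contradiction (LO.refl U) (none k)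
  value-at k (inj₂ (c , c≤k , max)) = LO.antisym V (pres c k c≤k) (pres k c (max k (LO.refl U)))

  h : Mono U V
  h = record { fun  = value ∘ below
             ; mono = λ {u} {u'} u≤u' → value-mono u≤u' (below u) (below u') }

◇-intro : ∀ {n} {V : LinOrd} (θ : Formula n) {μ : Fin n → Carrier V} →
          Sat V θ μ → Sat V (◇ θ) μ
◇-intro {V = V} θ s = V , idₘ , s

◇-transfer : ∀ {m} {U V : LinOrd} → Decidable (_≤ₒ_ U) → (θ : Formula (suc m))
             {ν : Fin (suc m) → Carrier U} {μ : Fin (suc m) → Carrier V} →
             MonoOn U V ν μ → Sat V (◇ θ) μ → Sat U (◇ θ) ν
◇-transfer _≤?_ θ {ν} {μ} pres (W , f , s) with monotone-extension _≤?_ ν μ pres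
... | h , h∘ν≗μ = W , f ∘ₘ h , Sat-cong W θ (cong (fun f) ∘ sym ∘ h∘ν≗μ) s

record Realizes {n} (U : LinOrd) (P : OPart n) (ν : Fin n → Carrier U) : Set where
  constructor realizes
  field
    blk≤⇔≤ : ∀ i j → blk P i ≤ blk P j ⇔ _≤ₒ_ U (ν i) (ν j)

open Realizes

Realization : ∀ {n} (U : LinOrd) → (Fin n → Carrier U) → Set
Realization {n} U ν = Σ[ P ∈ OPart n ] Realizes U P ν

Realizes⇒HoldsP : ∀ {n} {U : LinOrd} {P : OPart n} {ν} → Realizes U P ν → HoldsP U P ν
Realizes⇒HoldsP {U = U} (realizes R) i j =
  (λ e → LO.antisym U (to (R i j) (≤-reflexive e)) (to (R j i) (≤-reflexive (sym e)))) ,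
  (λ lt → to (R i j) (<⇒≤ lt) , λ e → <⇒≱ lt (from (R j i) (LO.reflexive U (sym e))))

HoldsP⇒Realizes : ∀ {n} {U : LinOrd} {P : OPart n} {ν} → HoldsP U P ν → Realizes U P ν
HoldsP⇒Realizes {U = U} {P} {ν} H = realizes λ i j → mk⇔ (blk≤⇒≤ i j) (≤⇒blk≤ i j)
  where
  blk≤⇒≤ : ∀ i j → blk P i ≤ blk P j → _≤ₒ_ U (ν i) (ν j)
  blk≤⇒≤ i j le with <-cmp (blk P i) (blk P j)
  ... | tri< lt _ _ = proj₁ (proj₂ (H i j) lt)
  ... | tri≈ _ e _  = LO.reflexive U (proj₁ (H i j) e)
  ... | tri> _ _ gt = contradiction le (<⇒≱ gt)

  ≤⇒blk≤ : ∀ i j → _≤ₒ_ U (ν i) (ν j) → blk P i ≤ blk P j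
  ≤⇒blk≤ i j le with <-cmp (blk P i) (blk P j)
  ... | tri< lt _ _ = <⇒≤ lt
  ... | tri≈ _ e _  = ≤-reflexive e
  ... | tri> _ _ gt with H j i
  ...   | _ , strict = contradiction (LO.antisym U (proj₁ (strict gt)) le) (proj₂ (strict gt))

module _ {n} (U : LinOrd) (ν : Fin (suc n) → Carrier U)
         (P : OPart n) (R : Realizes U P (ν ∘ suc)) where

  joinBlock : (c : Fin n) → ν (suc c) ≡ ν zero → Realization U ν
  joinBlock c c≡0 = record { r = r P ; blk = blk P ∘ σ ; surj = surj′ } , realizes λ i j →
    subst₂ (λ x y → blk P (σ i) ≤ blk P (σ j) ⇔ _≤ₒ_ U x y)
           (ν∘σ≗ν i) (ν∘σ≗ν j) (blk≤⇔≤ R (σ i) (σ j))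
    where
    σ : Fin (suc n) → Fin n
    σ zero    = c
    σ (suc i) = i
    ν∘σ≗ν : ν ∘ suc ∘ σ ≗ ν
    ν∘σ≗ν zero    = c≡0
    ν∘σ≗ν (suc i) = refl
    surj′ : ∀ k → Σ[ i ∈ Fin (suc n) ] blk P (σ i) ≡ k
    surj′ k = suc (proj₁ (surj P k)) , proj₂ (surj P k)

  newBlock : (p : Fin (suc (r P))) →
             (∀ i → blk P i < p ⇔ _≤ₒ_ U (ν (suc i)) (ν zero)) →
             (∀ i → ν (suc i) ≢ ν zero) → Realization U ν
  newBlock p below fresh = P′ , realizes R′
    where
    blk′ : Fin (suc n) → Fin (suc (r P))
    blk′ zero    = p
    blk′ (suc i) = punchIn p (blk P i)

    surj′ : ∀ k → Σ[ i ∈ Fin (suc n) ] blk′ i ≡ k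
    surj′ k with p ≟ k
    ... | yes refl = zero , refl
    ... | no p≢k with surj P (punchOut p≢k)
    ...   | i , blk-i≡k′ = suc i , trans (cong (punchIn p) blk-i≡k′) (punchIn-punchOut p≢k)

    P′ : OPart (suc n)
    P′ = record { r = suc (r P) ; blk = blk′ ; surj = surj′ }

    R′ : ∀ i j → blk′ i ≤ blk′ j ⇔ _≤ₒ_ U (ν i) (ν j)
    R′ zero    zero    = mk⇔ (λ _ → LO.refl U) (λ _ → ≤-reflexive refl)
    R′ (suc i) (suc j) = blk≤⇔≤ R i j
                     ⇔-∘ mk⇔ (punchIn-cancel-≤ p _ _) (punchIn-mono-≤ p _ _)
    R′ (suc i) zero    = below i ⇔-∘ punchIn≤⇔< p (blk P i)
    R′ zero    (suc j) = ⇔-sym (≥⇔≰ (isTotalOrder U) (fresh j))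
                     ⇔-∘ (¬-cong-⇔ (R′ (suc j) zero)
                     ⇔-∘ ≥⇔≰ ≤-isTotalOrder (punchInᵢ≢i p (blk P j)))

realize : (U : LinOrd) → Decidable (_≤ₒ_ U) → ∀ {n} (ν : Fin n → Carrier U) → Realization U ν
realize U _≤?_ {zero} ν = record { r = 0 ; blk = λ () ; surj = λ () } , realizes λ ()
realize U _≤?_ {suc n} ν with realize U _≤?_ (ν ∘ suc)
                            | greatestBelow U _≤?_ (ν ∘ suc) (ν zero)
... | P , R | inj₁ none =
  newBlock U ν P R zero (λ i → mk⇔ (λ ()) (λ i≤0 → contradiction i≤0 (none i)))
                        (λ i i≡0 → none i (LO.reflexive U i≡0))
... | P , R | inj₂ (c , c≤0 , max) with ν zero ≤? ν (suc c)
...   | yes 0≤c = joinBlock U ν P R c (LO.antisym U c≤0 0≤c)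
...   | no 0⋠c  = newBlock U ν P R (suc (blk P c)) below fresh
  where
  below : ∀ i → blk P i < suc (blk P c) ⇔ _≤ₒ_ U (ν (suc i)) (ν zero)
  below i = mk⇔ (λ i≤c → LO.trans U i≤c c≤0) (max i)
            ⇔-∘ (blk≤⇔≤ R i c ⇔-∘ mk⇔ s≤s⁻¹ s≤s)
  fresh : ∀ i → ν (suc i) ≢ ν zero
  fresh i i≡0 = 0⋠c (subst (λ x → _≤ₒ_ U x (ν (suc c))) i≡0 (max i (LO.reflexive U i≡0)))

module _ {n} {U V : LinOrd} {P Q : OPart n} {ν : Fin n → Carrier U} {μ : Fin n → Carrier V}
         (RP : Realizes U P ν) (RQ : Realizes V Q μ) where

  MonoOn⇒≼ : MonoOn U V ν μ → P ≼ Q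
  MonoOn⇒≼ pres = g , g-mono , factor
    where
    blk-mono : ∀ {i j} → blk P i ≤ blk P j → blk Q i ≤ blk Q j
    blk-mono {i} {j} = from (blk≤⇔≤ RQ i j) ∘ pres i j ∘ to (blk≤⇔≤ RP i j)
    rep : Fin (r P) → Fin n
    rep k = proj₁ (surj P k)
    blk-rep : ∀ k → blk P (rep k) ≡ k
    blk-rep k = proj₂ (surj P k)
    g : Fin (r P) → Fin (r Q)
    g = blk Q ∘ rep
    g-mono : ∀ {k l} → k ≤ l → g k ≤ g l
    g-mono {k} {l} = blk-mono ∘ subst₂ _≤_ (sym (blk-rep k)) (sym (blk-rep l))
    factor : ∀ i → blk Q i ≡ g (blk P i)
    factor i = ≤-antisym (blk-mono (≤-reflexive (sym (blk-rep (blk P i)))))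
                         (blk-mono (≤-reflexive (blk-rep (blk P i))))

  ≼⇒MonoOn : P ≼ Q → MonoOn U V ν μ
  ≼⇒MonoOn (g , g-mono , factor) i j =
    to (blk≤⇔≤ RQ i j) ∘ subst₂ _≤_ (sym (factor i)) (sym (factor j))
                      ∘ g-mono ∘ from (blk≤⇔≤ RP i j)

module Classical (em : ExcludedMiddle (lsuc lzero)) where

  _≤?_ : (U : LinOrd) → Decidable (_≤ₒ_ U)
  (U ≤? x) y = map′ lower lift em

  ◇⇔DiamondNF : (n : ℕ) (θ : Formula (suc n)) (U : LinOrd) (ν : Fin (suc n) → Carrier U) →
                Sat U (◇ θ) ν ⇔₁ DiamondNF θ U ν
  ◇⇔DiamondNF n θ U ν = fwd , bwd
    where
    fwd : Sat U (◇ θ) ν → DiamondNF θ U ν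
    fwd (V , f , s) with realize U (U ≤?_) ν | realize V (V ≤?_) (fun f ∘ ν)
    ... | P , RP | Q , RQ = Q , (V , fun f ∘ ν , lift (Realizes⇒HoldsP RQ) , s) ,
                            P , lift (MonoOn⇒≼ RP RQ (λ _ _ → mono f) , Realizes⇒HoldsP RP)

    bwd : DiamondNF θ U ν → Sat U (◇ θ) ν
    bwd (Q , (V , μ , lift HQ , s) , P , lift (P≼Q , HP)) =
      ◇-transfer (U ≤?_) θ (≼⇒MonoOn RP RQ P≼Q) (◇-intro θ s)
      where
      RP = HoldsP⇒Realizes {U = U} {P} HP
      RQ = HoldsP⇒Realizes {U = V} {Q} HQ

  ◇-sentence : (θ : Formula zero) →
               ((U : LinOrd) (ν : Fin zero → Carrier U) → Sat U (◇ θ) ν ⇔₁ ⊥)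
               ⊎ ((U : LinOrd) (ν : Fin zero → Carrier U) → Sat U (◇ θ) ν ⇔₁ ⊤)
               ⊎ ((U : LinOrd) (ν : Fin zero → Carrier U) → Sat U (◇ θ) ν ⇔₁ IsEmptyOrder U)
  ◇-sentence θ with em {Σ[ V ∈ LinOrd ] Sat V θ (λ ())}
                  | em {Σ[ V ∈ LinOrd ] Carrier V × Sat V θ (λ ())}
  ... | no nowhere | _ =
    inj₁ λ U ν → (λ (V , f , s) → ⊥-elim (nowhere (V , Sat-cong V θ (λ ()) s))) , λ ()
  ... | yes _ | yes (V , v , s) =
    inj₂ (inj₁ λ U ν → (λ _ → tt) , λ _ → V , constₘ v , Sat-cong V θ (λ ()) s)
  ... | yes (V , s) | no onlyEmpty =
    inj₂ (inj₂ λ U ν →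
      (λ (W , f , t) u → ⊥-elim (onlyEmpty (W , fun f u , Sat-cong W θ (λ ()) t))) ,
      (λ empty → V , emptyₘ empty , Sat-cong V θ (λ ()) s))

  fromDec : ∀ {n} {A : Set₁} → Dec A → Formula n
  fromDec (yes _) = ⊤'
  fromDec (no _)  = ⊥'

  branch : ∀ {n} → List (Fin n × Fin n) → (List Bool → Set₁) → Formula n
  branch []             G = fromDec (em {G []})
  branch ((i , j) ∷ ps) G =
    ((i ≤' j) ∧' branch ps (G ∘ (true ∷_)))
    ∨' ((¬' (i ≤' j)) ∧' branch ps (G ∘ (false ∷_)))

  branch-modalFree : ∀ {n} (ps : List (Fin n × Fin n)) (G : List Bool → Set₁) →
                     ModalFree (branch ps G)
  branch-modalFree [] G with em {G []}
  ... | yes _ = mf⊤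
  ... | no _  = mf⊥
  branch-modalFree ((i , j) ∷ ps) G =
    mf∨ (mf∧ (mf≤ i j) (branch-modalFree ps _)) (mf∧ (mf¬ (mf≤ i j)) (branch-modalFree ps _))

  orderType : ∀ {n} (U : LinOrd) → (Fin n → Carrier U) → List (Fin n × Fin n) → List Bool
  orderType U ν = map (uncurry λ i j → does ((U ≤? ν i) (ν j)))

  branch-sat : ∀ {n} (U : LinOrd) (ν : Fin n → Carrier U)
               (ps : List (Fin n × Fin n)) (G : List Bool → Set₁) →
               Sat U (branch ps G) ν ⇔₁ G (orderType U ν ps)
  branch-sat U ν [] G with em {G []}
  ... | yes g = (λ _ → g) , (λ _ → tt)
  ... | no ¬g = (λ ()) , (λ g → contradiction g ¬g)
  branch-sat U ν ((i , j) ∷ ps) G = on ((U ≤? ν i) (ν j))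
    where
    IH : ∀ b → Sat U (branch ps (G ∘ (b ∷_))) ν ⇔₁ G (b ∷ orderType U ν ps)
    IH b = branch-sat U ν ps (G ∘ (b ∷_))

    on : (i≤?j : Dec (_≤ₒ_ U (ν i) (ν j))) →
         Sat U (branch ((i , j) ∷ ps) G) ν ⇔₁ G (does i≤?j ∷ orderType U ν ps)
    on (yes i≤j) =
      (λ { (inj₁ (_ , s))   → proj₁ (IH true) s
         ; (inj₂ (i⋠j , _)) → ⊥-elim (lower (i⋠j (lift i≤j))) }) ,
      (λ g → inj₁ (lift i≤j , proj₂ (IH true) g))
    on (no i⋠j) =
      (λ { (inj₁ (lift i≤j , _)) → contradiction i≤j i⋠j
         ; (inj₂ (_ , s))        → proj₁ (IH false) s }) ,
      (λ g → inj₂ ((λ (lift i≤j) → ⊥-elim (i⋠j i≤j)) , proj₂ (IH false) g))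

  allPairs : ∀ n → List (Fin n × Fin n)
  allPairs n = cartesianProduct (allFin n) (allFin n)

  orderType-≡⇒MonoOn : ∀ {n} (U V : LinOrd) {ν : Fin n → Carrier U} {μ : Fin n → Carrier V} →
                       orderType U ν (allPairs n) ≡ orderType V μ (allPairs n) → MonoOn U V ν μ
  orderType-≡⇒MonoOn {n} U V {ν} {μ} e i j =
    does-≡⇒ ((U ≤? ν i) (ν j)) ((V ≤? μ i) (μ j))
            (map-≡-∈ (allPairs n) e (∈-cartesianProduct⁺ (∈-allFin i) (∈-allFin j)))

  modalFree-of-MonoOn-closed :
    ∀ {n} (Φ : (U : LinOrd) → (Fin n → Carrier U) → Set₁) →
    (∀ {U V ν μ} → MonoOn U V ν μ → Φ V μ → Φ U ν) →
    Σ[ ψ ∈ Formula n ] ModalFree ψ ×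
      ((U : LinOrd) (ν : Fin n → Carrier U) → Φ U ν ⇔₁ Sat U ψ ν)
  modalFree-of-MonoOn-closed {n} Φ closed =
    branch (allPairs n) G , branch-modalFree (allPairs n) G ,
    λ U ν → (λ φ → proj₂ (branch-sat U ν (allPairs n) G) (U , ν , refl , φ)) ,
            (λ s → let (V , μ , e , φ) = proj₁ (branch-sat U ν (allPairs n) G) s
                   in closed (orderType-≡⇒MonoOn U V (sym e)) φ)
    where
    G : List Bool → Set₁
    G bs = Σ[ V ∈ LinOrd ] Σ[ μ ∈ (Fin n → Carrier V) ]
             (orderType V μ (allPairs n) ≡ bs) × Φ V μ

  ◇-modalFree : (n : ℕ) (θ : Formula n) →
                Σ[ ψ ∈ Formula n ] ModalFree ψ ×
                  ((U : LinOrd) (ν : Fin n → Carrier U) → Sat U (◇ θ) ν ⇔₁ Sat U ψ ν)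
  ◇-modalFree zero θ with ◇-sentence θ
  ... | inj₁ never          = ⊥' , mf⊥ , never
  ... | inj₂ (inj₁ always)  = ⊤' , mf⊤ , always
  ... | inj₂ (inj₂ ifEmpty) = ∀' ⊥' , mf∀ mf⊥ , ifEmpty
  ◇-modalFree (suc m) θ =
    modalFree-of-MonoOn-closed (λ U → Sat U (◇ θ)) (λ {U} → ◇-transfer (U ≤?_) θ)

theorem4p3 : ExcludedMiddle (lsuc lzero) →
    ((n : ℕ) (θ : Formula n) →
       Σ[ ψ ∈ Formula n ] ModalFree ψ ×
         ((U : LinOrd) (ν : Fin n → Carrier U) → Sat U (◇ θ) ν ⇔₁ Sat U ψ ν))
    × ((n : ℕ) (θ : Formula (suc n)) (U : LinOrd) (ν : Fin (suc n) → Carrier U) →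
         Sat U (◇ θ) ν ⇔₁ DiamondNF θ U ν)
    × ((θ : Formula zero) →
         ((U : LinOrd) (ν : Fin zero → Carrier U) → Sat U (◇ θ) ν ⇔₁ ⊥)
         ⊎ ((U : LinOrd) (ν : Fin zero → Carrier U) → Sat U (◇ θ) ν ⇔₁ ⊤)
         ⊎ ((U : LinOrd) (ν : Fin zero → Carrier U) → Sat U (◇ θ) ν ⇔₁ IsEmptyOrder U))
theorem4p3 em = ◇-modalFree , ◇⇔DiamondNF , ◇-sentence
  where open Classical em
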